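{- For every Boolean algebra $\mathcal{B}$, the twist structure $\mathcal{T}_\mathcal{B}$ is a bounded lattice whose infimum and supremum operations are $\tilde\land$ and $\tilde\lor$, respectively, and whose top and bottom elements are $T=(1,0,1)$ and $F=(0,1,1)$ (where $1$ and $0$ are the top and bottom of $\mathcal{B}$).
   Context: For a Boolean algebra $\mathcal{B}=\langle\mathbf{B},\sqcap,\sqcup,\Rightarrow,\sim,0,1\rangle$, the twist structure $\mathcal{T}_\mathcal{B}$ is the algebra with domain $B^{\mathcal{B}}_{LET_K}=\{z=(z_1,z_2,z_3)\in\mathbf{B}^3: z_3\le z_1\sqcup z_2,\ z_1\sqcap z_2\sqcap z_3=0\}$ and operations $z\tilde\land w=(z_1\sqcap w_1,\ z_2\sqcup w_2,\ (z_1\sqcap z_3\sqcap w_1\sqcap w_3)\sqcup(z_2\sqcap z_3)\sqcup(w_2\sqcap w_3))$; $z\tilde\lor w=(z_1\sqcup w_1,\ z_2\sqcap w_2,\ (z_2\sqcap z_3\sqcap w_2\sqcap w_3)\sqcup(z_1\sqcap z_3)\sqcup(w_1\sqcap w_3))$; $z\tilde\to w=(z_1\Rightarrow w_1,\ z_1\sqcap w_2,\ (z_1\sqcap w_2\sqcap w_3)\sqcup(z_2\sqcap z_3)\sqcup(w_1\sqcap w_3))$; $\tilde\neg z=(z_2,z_1,z_3)$; $\tilde\circ z=(z_3,\sim z_3,1)$. "Lattice" is meant algebraically: $\tilde\land,\tilde\lor$ are idempotent, commutative, associative and satisfy absorption, with order $z\le w$ iff $z=z\tilde\land w$. -}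

module Defs where

open import Level using (Level; _⊔_)
open import Data.Product using (_×_; _,_; proj₁; proj₂)
open import Algebra.Lattice.Bundles using (BooleanAlgebra)

module Twist {c ℓ : Level} (𝓑 : BooleanAlgebra c ℓ) where
  open BooleanAlgebra 𝓑

  Triple : Set c
  Triple = Carrier × Carrier × Carrier

  π₁ π₂ π₃ : Triple → Carrier
  π₁ (a , _ , _) = a
  π₂ (_ , b , _) = b
  π₃ (_ , _ , d) = d

  _≤ᴮ_ : Carrier → Carrier → Set ℓ
  x ≤ᴮ y = (x ∧ y) ≈ x

  InDom : Triple → Set ℓ
  InDom z = (π₃ z ≤ᴮ (π₁ z ∨ π₂ z)) × ((π₁ z ∧ π₂ z ∧ π₃ z) ≈ ⊥)

  _≋_ : Triple → Triple → Set ℓ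
  z ≋ w = (π₁ z ≈ π₁ w) × (π₂ z ≈ π₂ w) × (π₃ z ≈ π₃ w)

  _∧̃_ : Triple → Triple → Triple
  z ∧̃ w = (π₁ z ∧ π₁ w)
        , (π₂ z ∨ π₂ w)
        , ((π₁ z ∧ π₃ z ∧ π₁ w ∧ π₃ w) ∨ (π₂ z ∧ π₃ z) ∨ (π₂ w ∧ π₃ w))

  _∨̃_ : Triple → Triple → Triple
  z ∨̃ w = (π₁ z ∨ π₁ w)
        , (π₂ z ∧ π₂ w)
        , ((π₂ z ∧ π₃ z ∧ π₂ w ∧ π₃ w) ∨ (π₁ z ∧ π₃ z) ∨ (π₁ w ∧ π₃ w))

  T̃ F̃ : Triple
  T̃ = ⊤ , ⊥ , ⊤
  F̃ = ⊥ , ⊤ , ⊤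

  _≤̃_ : Triple → Triple → Set ℓ
  z ≤̃ w = z ≋ (z ∧̃ w)

  IsBoundedTwistLattice : Set (c ⊔ ℓ)
  IsBoundedTwistLattice =
      (∀ z w → InDom z → InDom w → InDom (z ∧̃ w))
    × (∀ z w → InDom z → InDom w → InDom (z ∨̃ w))
    × InDom T̃ × InDom F̃
    × (∀ z → InDom z → (z ∧̃ z) ≋ z)
    × (∀ z → InDom z → (z ∨̃ z) ≋ z)
    × (∀ z w → InDom z → InDom w → (z ∧̃ w) ≋ (w ∧̃ z))
    × (∀ z w → InDom z → InDom w → (z ∨̃ w) ≋ (w ∨̃ z))
    × (∀ z w u → InDom z → InDom w → InDom u → ((z ∧̃ w) ∧̃ u) ≋ (z ∧̃ (w ∧̃ u)))
    × (∀ z w u → InDom z → InDom w → InDom u → ((z ∨̃ w) ∨̃ u) ≋ (z ∨̃ (w ∨̃ u)))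
    × (∀ z w → InDom z → InDom w → (z ∧̃ (z ∨̃ w)) ≋ z)
    × (∀ z w → InDom z → InDom w → (z ∨̃ (z ∧̃ w)) ≋ z)
    × (∀ z → InDom z → z ≤̃ T̃)
    × (∀ z → InDom z → F̃ ≤̃ z)

-- Every operation of the twist structure is computed componentwise by Boolean
-- terms, so each lattice law is an identity between triples of Boolean terms.
-- Such an identity holds in every Boolean algebra as soon as it holds in the
-- two-element one (Shannon expansion), hence it can be decided by truth tables.
-- The domain conditions z₃ ≤ z₁ ⊔ z₂ and z₁ ⊓ z₂ ⊓ z₃ = 0 say exactly that
-- z₃ = z₃ ⊓ (z₁ ⊔ z₂) ⊓ ∼(z₁ ⊓ z₂); substituting this term for z₃ turns the
-- laws, which only hold on the domain, into unconditional identities.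
{-# OPTIONS --safe #-}
module Submission where

open import Defs
open import Algebra.Bundles using (IdempotentCommutativeMonoid)
open import Algebra.Lattice.Bundles using (BooleanAlgebra)
open import Data.Bool.Base as Bool using (Bool; true; false)
open import Data.Bool.Properties using () renaming (_≟_ to _≟ᵇ_)
open import Data.Fin using (Fin; zero; suc; #_)
open import Data.Nat.Base using (ℕ; zero; suc)
open import Data.Product.Base using (_×_; _,_)
open import Level using (_⊔_)
open import Data.Vec.Base using (Vec; []; _∷_; lookup)
open import Data.Vec.Relation.Binary.Pointwise.Inductive using (Pointwise; []; _∷_)
open import Relation.Binary.PropositionalEquality as ≡ using (_≡_)
open import Relation.Nullary.Decidable using (Dec; True; map′; _×-dec_; toWitness)

∀-assignments? : ∀ {n} {P : Vec Bool n → Set} →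
                 (∀ bs → Dec (P bs)) → Dec (∀ bs → P bs)
∀-assignments? {zero} P? = map′ (λ { p [] → p }) (λ ∀P → ∀P []) (P? [])
∀-assignments? {suc n} P? =
  map′ (λ { (∀Pᵗ , ∀Pᶠ) (true ∷ bs) → ∀Pᵗ bs ; (∀Pᵗ , ∀Pᶠ) (false ∷ bs) → ∀Pᶠ bs })
       (λ ∀P → (λ bs → ∀P (true ∷ bs)) , (λ bs → ∀P (false ∷ bs)))
       (∀-assignments? (λ bs → P? (true ∷ bs)) ×-dec ∀-assignments? (λ bs → P? (false ∷ bs)))

module BooleanAlgebraSolver {c ℓ} (𝓑 : BooleanAlgebra c ℓ) where
  open BooleanAlgebra 𝓑
  open import Algebra.Lattice.Properties.BooleanAlgebra 𝓑
  open import Relation.Binary.Reasoning.Setoid setoid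

  ∧-idempotentCommutativeMonoid : IdempotentCommutativeMonoid c ℓ
  ∧-idempotentCommutativeMonoid = record
    { isIdempotentCommutativeMonoid = record
      { isCommutativeMonoid = ∧-⊤-isCommutativeMonoid ; idem = ∧-idem } }

  open import Algebra.Properties.IdempotentCommutativeMonoid ∧-idempotentCommutativeMonoid
    using () renaming (∙-distrʳ-∙ to ∧-distribʳ-∧)

  infixr 7 _∧ₑ_
  infixr 6 _∨ₑ_
  infix 8 ¬ₑ_
  infix 9 _[_]
  infix 4 _⇔ᵇ_

  data Expr (n : ℕ) : Set where
    var       : Fin n → Expr n
    _∧ₑ_ _∨ₑ_ : Expr n → Expr n → Expr n
    ¬ₑ_       : Expr n → Expr n
    const     : Bool → Expr n

  ⊤ₑ ⊥ₑ : ∀ {n} → Expr n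
  ⊤ₑ = const true
  ⊥ₑ = const false

  fromBool : Bool → Carrier
  fromBool true  = ⊤
  fromBool false = ⊥

  ⟦_⟧ : ∀ {n} → Expr n → Vec Carrier n → Carrier
  ⟦ var i   ⟧ ρ = lookup ρ i
  ⟦ a ∧ₑ b  ⟧ ρ = ⟦ a ⟧ ρ ∧ ⟦ b ⟧ ρ
  ⟦ a ∨ₑ b  ⟧ ρ = ⟦ a ⟧ ρ ∨ ⟦ b ⟧ ρ
  ⟦ ¬ₑ a    ⟧ ρ = ¬ ⟦ a ⟧ ρ
  ⟦ const b ⟧ ρ = fromBool b

  ⟦_⟧ᵇ : ∀ {n} → Expr n → Vec Bool n → Bool
  ⟦ var i   ⟧ᵇ bs = lookup bs i
  ⟦ a ∧ₑ b  ⟧ᵇ bs = ⟦ a ⟧ᵇ bs Bool.∧ ⟦ b ⟧ᵇ bs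
  ⟦ a ∨ₑ b  ⟧ᵇ bs = ⟦ a ⟧ᵇ bs Bool.∨ ⟦ b ⟧ᵇ bs
  ⟦ ¬ₑ a    ⟧ᵇ bs = Bool.not (⟦ a ⟧ᵇ bs)
  ⟦ const b ⟧ᵇ bs = b

  fromBool-∧ : ∀ a b → fromBool a ∧ fromBool b ≈ fromBool (a Bool.∧ b)
  fromBool-∧ true  b = ∧-identityˡ (fromBool b)
  fromBool-∧ false b = ∧-zeroˡ (fromBool b)

  fromBool-∨ : ∀ a b → fromBool a ∨ fromBool b ≈ fromBool (a Bool.∨ b)
  fromBool-∨ true  b = ∨-zeroˡ (fromBool b)
  fromBool-∨ false b = ∨-identityˡ (fromBool b)

  fromBool-¬ : ∀ a → ¬ fromBool a ≈ fromBool (Bool.not a)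
  fromBool-¬ true  = ¬⊤≈⊥
  fromBool-¬ false = ¬⊥≈⊤

  ⟦⟧-closed : (e : Expr 0) → ⟦ e ⟧ [] ≈ fromBool (⟦ e ⟧ᵇ [])
  ⟦⟧-closed (a ∧ₑ b)  =
    trans (∧-cong (⟦⟧-closed a) (⟦⟧-closed b)) (fromBool-∧ (⟦ a ⟧ᵇ []) (⟦ b ⟧ᵇ []))
  ⟦⟧-closed (a ∨ₑ b)  =
    trans (∨-cong (⟦⟧-closed a) (⟦⟧-closed b)) (fromBool-∨ (⟦ a ⟧ᵇ []) (⟦ b ⟧ᵇ []))
  ⟦⟧-closed (¬ₑ a)    = trans (¬-cong (⟦⟧-closed a)) (fromBool-¬ (⟦ a ⟧ᵇ []))
  ⟦⟧-closed (const b) = refl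

  instantiate : ∀ {n} → Bool → Expr (suc n) → Expr n
  instantiate b (var zero)    = const b
  instantiate b (var (suc i)) = var i
  instantiate b (e ∧ₑ f)      = instantiate b e ∧ₑ instantiate b f
  instantiate b (e ∨ₑ f)      = instantiate b e ∨ₑ instantiate b f
  instantiate b (¬ₑ e)        = ¬ₑ instantiate b e
  instantiate b (const b′)    = const b′

  ⟦instantiate⟧ᵇ : ∀ {n} b (bs : Vec Bool n) e →
                   ⟦ instantiate b e ⟧ᵇ bs ≡ ⟦ e ⟧ᵇ (b ∷ bs)
  ⟦instantiate⟧ᵇ b bs (var zero)    = ≡.refl
  ⟦instantiate⟧ᵇ b bs (var (suc i)) = ≡.refl
  ⟦instantiate⟧ᵇ b bs (e ∧ₑ f)      = ≡.cong₂ Bool._∧_ (⟦instantiate⟧ᵇ b bs e) (⟦instantiate⟧ᵇ b bs f)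
  ⟦instantiate⟧ᵇ b bs (e ∨ₑ f)      = ≡.cong₂ Bool._∨_ (⟦instantiate⟧ᵇ b bs e) (⟦instantiate⟧ᵇ b bs f)
  ⟦instantiate⟧ᵇ b bs (¬ₑ e)        = ≡.cong Bool.not (⟦instantiate⟧ᵇ b bs e)
  ⟦instantiate⟧ᵇ b bs (const b′)    = ≡.refl

  ¬-∧-relativeʳ : ∀ a y → ¬ a ∧ y ≈ ¬ (a ∧ y) ∧ y
  ¬-∧-relativeʳ a y = sym (begin
    ¬ (a ∧ y) ∧ y         ≈⟨ ∧-congʳ (deMorgan₁ a y) ⟩
    (¬ a ∨ ¬ y) ∧ y       ≈⟨ ∧-distribʳ-∨ y (¬ a) (¬ y) ⟩
    (¬ a ∧ y) ∨ (¬ y ∧ y) ≈⟨ ∨-congˡ (∧-complementˡ y) ⟩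
    (¬ a ∧ y) ∨ ⊥         ≈⟨ ∨-identityʳ _ ⟩
    ¬ a ∧ y               ∎)

  ⟦instantiate⟧-∧ : ∀ {n} b x y (ρ : Vec Carrier n) → x ∧ y ≈ fromBool b ∧ y →
                    ∀ e → ⟦ e ⟧ (x ∷ ρ) ∧ y ≈ ⟦ instantiate b e ⟧ ρ ∧ y
  ⟦instantiate⟧-∧ b x y ρ x≈b (var zero)    = x≈b
  ⟦instantiate⟧-∧ b x y ρ x≈b (var (suc i)) = refl
  ⟦instantiate⟧-∧ b x y ρ x≈b (e ∧ₑ f) = begin
    (⟦ e ⟧ (x ∷ ρ) ∧ ⟦ f ⟧ (x ∷ ρ)) ∧ y         ≈⟨ ∧-distribʳ-∧ y _ _ ⟩
    (⟦ e ⟧ (x ∷ ρ) ∧ y) ∧ (⟦ f ⟧ (x ∷ ρ) ∧ y)   ≈⟨ ∧-cong (⟦instantiate⟧-∧ b x y ρ x≈b e)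
                                                         (⟦instantiate⟧-∧ b x y ρ x≈b f) ⟩
    (⟦ instantiate b e ⟧ ρ ∧ y) ∧ (⟦ instantiate b f ⟧ ρ ∧ y) ≈⟨ ∧-distribʳ-∧ y _ _ ⟨
    (⟦ instantiate b e ⟧ ρ ∧ ⟦ instantiate b f ⟧ ρ) ∧ y       ∎
  ⟦instantiate⟧-∧ b x y ρ x≈b (e ∨ₑ f) = begin
    (⟦ e ⟧ (x ∷ ρ) ∨ ⟦ f ⟧ (x ∷ ρ)) ∧ y         ≈⟨ ∧-distribʳ-∨ y _ _ ⟩
    (⟦ e ⟧ (x ∷ ρ) ∧ y) ∨ (⟦ f ⟧ (x ∷ ρ) ∧ y)   ≈⟨ ∨-cong (⟦instantiate⟧-∧ b x y ρ x≈b e)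
                                                         (⟦instantiate⟧-∧ b x y ρ x≈b f) ⟩
    (⟦ instantiate b e ⟧ ρ ∧ y) ∨ (⟦ instantiate b f ⟧ ρ ∧ y) ≈⟨ ∧-distribʳ-∨ y _ _ ⟨
    (⟦ instantiate b e ⟧ ρ ∨ ⟦ instantiate b f ⟧ ρ) ∧ y       ∎
  ⟦instantiate⟧-∧ b x y ρ x≈b (¬ₑ e) = begin
    ¬ ⟦ e ⟧ (x ∷ ρ) ∧ y                  ≈⟨ ¬-∧-relativeʳ _ y ⟩
    ¬ (⟦ e ⟧ (x ∷ ρ) ∧ y) ∧ y            ≈⟨ ∧-congʳ (¬-cong (⟦instantiate⟧-∧ b x y ρ x≈b e)) ⟩
    ¬ (⟦ instantiate b e ⟧ ρ ∧ y) ∧ y    ≈⟨ ¬-∧-relativeʳ _ y ⟨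
    ¬ ⟦ instantiate b e ⟧ ρ ∧ y          ∎
  ⟦instantiate⟧-∧ b x y ρ x≈b (const b′) = refl

  ∧-∨-split : ∀ a x → (a ∧ x) ∨ (a ∧ ¬ x) ≈ a
  ∧-∨-split a x = begin
    (a ∧ x) ∨ (a ∧ ¬ x) ≈⟨ ∧-distribˡ-∨ a x (¬ x) ⟨
    a ∧ (x ∨ ¬ x)       ≈⟨ ∧-congˡ (∨-complementʳ x) ⟩
    a ∧ ⊤               ≈⟨ ∧-identityʳ a ⟩
    a                   ∎

  truth-table-sound : ∀ {n} (e f : Expr n) → (∀ bs → ⟦ e ⟧ᵇ bs ≡ ⟦ f ⟧ᵇ bs) →
                      ∀ ρ → ⟦ e ⟧ ρ ≈ ⟦ f ⟧ ρ
  truth-table-sound e f e≡f [] = begin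
    ⟦ e ⟧ []               ≈⟨ ⟦⟧-closed e ⟩
    fromBool (⟦ e ⟧ᵇ [])   ≡⟨ ≡.cong fromBool (e≡f []) ⟩
    fromBool (⟦ f ⟧ᵇ [])   ≈⟨ ⟦⟧-closed f ⟨
    ⟦ f ⟧ []               ∎
  truth-table-sound e f e≡f (x ∷ ρ) = begin
    ⟦ e ⟧ (x ∷ ρ)                                           ≈⟨ ∧-∨-split _ x ⟨
    (⟦ e ⟧ (x ∷ ρ) ∧ x) ∨ (⟦ e ⟧ (x ∷ ρ) ∧ ¬ x)             ≈⟨ ∨-cong (below-x e) (below-¬x e) ⟩
    (⟦ instantiate true e ⟧ ρ ∧ x) ∨ (⟦ instantiate false e ⟧ ρ ∧ ¬ x)
      ≈⟨ ∨-cong (∧-congʳ (instances true)) (∧-congʳ (instances false)) ⟩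
    (⟦ instantiate true f ⟧ ρ ∧ x) ∨ (⟦ instantiate false f ⟧ ρ ∧ ¬ x)
      ≈⟨ ∨-cong (below-x f) (below-¬x f) ⟨
    (⟦ f ⟧ (x ∷ ρ) ∧ x) ∨ (⟦ f ⟧ (x ∷ ρ) ∧ ¬ x)             ≈⟨ ∧-∨-split _ x ⟩
    ⟦ f ⟧ (x ∷ ρ)                                           ∎
    where
    below-x : ∀ g → ⟦ g ⟧ (x ∷ ρ) ∧ x ≈ ⟦ instantiate true g ⟧ ρ ∧ x
    below-x = ⟦instantiate⟧-∧ true x x ρ (trans (∧-idem x) (sym (∧-identityˡ x)))

    below-¬x : ∀ g → ⟦ g ⟧ (x ∷ ρ) ∧ ¬ x ≈ ⟦ instantiate false g ⟧ ρ ∧ ¬ x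
    below-¬x = ⟦instantiate⟧-∧ false x (¬ x) ρ (trans (∧-complementʳ x) (sym (∧-zeroˡ (¬ x))))

    instances : ∀ b → ⟦ instantiate b e ⟧ ρ ≈ ⟦ instantiate b f ⟧ ρ
    instances b = truth-table-sound (instantiate b e) (instantiate b f)
      (λ bs → ≡.trans (⟦instantiate⟧ᵇ b bs e)
                (≡.trans (e≡f (b ∷ bs)) (≡.sym (⟦instantiate⟧ᵇ b bs f)))) ρ

  _⇔ᵇ_ : ∀ {n} → Expr n → Expr n → Set
  e ⇔ᵇ f = True (∀-assignments? (λ bs → ⟦ e ⟧ᵇ bs ≟ᵇ ⟦ f ⟧ᵇ bs))

  solve : ∀ {n} (e f : Expr n) → e ⇔ᵇ f → ∀ ρ → ⟦ e ⟧ ρ ≈ ⟦ f ⟧ ρ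
  solve e f e⇔f = truth-table-sound e f (toWitness e⇔f)

  _[_] : ∀ {n m} → Expr n → Vec (Expr m) n → Expr m
  var i   [ σ ] = lookup σ i
  (a ∧ₑ b) [ σ ] = a [ σ ] ∧ₑ b [ σ ]
  (a ∨ₑ b) [ σ ] = a [ σ ] ∨ₑ b [ σ ]
  (¬ₑ a)  [ σ ] = ¬ₑ (a [ σ ])
  const b [ σ ] = const b

  _Denotes_Under_ : ∀ {n m} → Vec Carrier n → Vec (Expr m) n → Vec Carrier m → Set (c ⊔ ℓ)
  ρ Denotes σ Under ρ′ = Pointwise (λ x s → x ≈ ⟦ s ⟧ ρ′) ρ σ

  ⟦⟧-[] : ∀ {n m} {ρ : Vec Carrier n} {σ : Vec (Expr m) n} {ρ′} →
          ρ Denotes σ Under ρ′ → ∀ e → ⟦ e ⟧ ρ ≈ ⟦ e [ σ ] ⟧ ρ′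
  ⟦⟧-[] (x≈s ∷ _)   (var zero)    = x≈s
  ⟦⟧-[] (_ ∷ ρ≈σ)   (var (suc i)) = ⟦⟧-[] ρ≈σ (var i)
  ⟦⟧-[] ρ≈σ         (a ∧ₑ b)      = ∧-cong (⟦⟧-[] ρ≈σ a) (⟦⟧-[] ρ≈σ b)
  ⟦⟧-[] ρ≈σ         (a ∨ₑ b)      = ∨-cong (⟦⟧-[] ρ≈σ a) (⟦⟧-[] ρ≈σ b)
  ⟦⟧-[] ρ≈σ         (¬ₑ a)        = ¬-cong (⟦⟧-[] ρ≈σ a)
  ⟦⟧-[] ρ≈σ         (const b)     = refl

  solve-under : ∀ {n} (σ : Vec (Expr n) n) (e f : Expr n) → e [ σ ] ⇔ᵇ f [ σ ] →
                ∀ {ρ} → ρ Denotes σ Under ρ → ⟦ e ⟧ ρ ≈ ⟦ f ⟧ ρ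
  solve-under σ e f e⇔f {ρ} ρ≈σ = begin
    ⟦ e ⟧ ρ         ≈⟨ ⟦⟧-[] ρ≈σ e ⟩
    ⟦ e [ σ ] ⟧ ρ   ≈⟨ solve (e [ σ ]) (f [ σ ]) e⇔f ρ ⟩
    ⟦ f [ σ ] ⟧ ρ   ≈⟨ ⟦⟧-[] ρ≈σ f ⟨
    ⟦ f ⟧ ρ         ∎

module TwistTruthTables {c ℓ} (𝓑 : BooleanAlgebra c ℓ) where
  open BooleanAlgebra 𝓑
  open import Algebra.Lattice.Properties.BooleanAlgebra 𝓑
  open import Relation.Binary.Reasoning.Setoid setoid
  open BooleanAlgebraSolver 𝓑
  open Twist 𝓑

  infix 4 _⇔ᵗ_

  TripleExpr : ℕ → Set
  TripleExpr n = Expr n × Expr n × Expr n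

  ⟦_⟧³ : ∀ {n} → TripleExpr n → Vec Carrier n → Triple
  ⟦ a , b , d ⟧³ ρ = ⟦ a ⟧ ρ , ⟦ b ⟧ ρ , ⟦ d ⟧ ρ

  _∧ᵗ_ _∨ᵗ_ : ∀ {n} → TripleExpr n → TripleExpr n → TripleExpr n
  (a₁ , a₂ , a₃) ∧ᵗ (b₁ , b₂ , b₃) =
    a₁ ∧ₑ b₁ , a₂ ∨ₑ b₂ , (a₁ ∧ₑ a₃ ∧ₑ b₁ ∧ₑ b₃) ∨ₑ (a₂ ∧ₑ a₃) ∨ₑ (b₂ ∧ₑ b₃)
  (a₁ , a₂ , a₃) ∨ᵗ (b₁ , b₂ , b₃) =
    a₁ ∨ₑ b₁ , a₂ ∧ₑ b₂ , (a₂ ∧ₑ a₃ ∧ₑ b₂ ∧ₑ b₃) ∨ₑ (a₁ ∧ₑ a₃) ∨ₑ (b₁ ∧ₑ b₃)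

  Tᵗ Fᵗ : ∀ {n} → TripleExpr n
  Tᵗ = ⊤ₑ , ⊥ₑ , ⊤ₑ
  Fᵗ = ⊥ₑ , ⊤ₑ , ⊤ₑ

  domain-normal-form : ∀ {n} → TripleExpr n → Expr n
  domain-normal-form (a , b , d) = d ∧ₑ (a ∨ₑ b) ∧ₑ ¬ₑ (a ∧ₑ b)

  InDom⇒π₃-normal : ∀ z → InDom z → π₃ z ≈ π₃ z ∧ (π₁ z ∨ π₂ z) ∧ ¬ (π₁ z ∧ π₂ z)
  InDom⇒π₃-normal z (π₃≤π₁∨π₂ , π₁∧π₂∧π₃≈⊥) = sym (begin
    π₃ z ∧ (π₁ z ∨ π₂ z) ∧ ¬ (π₁ z ∧ π₂ z)
      ≈⟨ solve (domain-normal-form (a , b , d)) ((d ∧ₑ (a ∨ₑ b)) ∧ₑ ¬ₑ (a ∧ₑ b ∧ₑ d)) _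
               (π₁ z ∷ π₂ z ∷ π₃ z ∷ []) ⟩
    (π₃ z ∧ (π₁ z ∨ π₂ z)) ∧ ¬ (π₁ z ∧ π₂ z ∧ π₃ z) ≈⟨ ∧-cong π₃≤π₁∨π₂ (¬-cong π₁∧π₂∧π₃≈⊥) ⟩
    π₃ z ∧ ¬ ⊥                                     ≈⟨ ∧-congˡ ¬⊥≈⊤ ⟩
    π₃ z ∧ ⊤                                       ≈⟨ ∧-identityʳ (π₃ z) ⟩
    π₃ z                                           ∎)
    where
    a b d : Expr 3
    a = var (# 0)
    b = var (# 1)
    d = var (# 2)

  T̃-InDom : InDom T̃
  T̃-InDom = trans (∧-identityˡ _) (∨-identityʳ ⊤) , trans (∧-identityˡ _) (∧-zeroˡ ⊤)

  F̃-InDom : InDom F̃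
  F̃-InDom = trans (∧-identityˡ _) (∨-identityˡ ⊤) , ∧-zeroˡ _

  x y u : TripleExpr 9
  x = var (# 0) , var (# 1) , var (# 2)
  y = var (# 3) , var (# 4) , var (# 5)
  u = var (# 6) , var (# 7) , var (# 8)

  env : Triple → Triple → Triple → Vec Carrier 9
  env z w v = π₁ z ∷ π₂ z ∷ π₃ z ∷ π₁ w ∷ π₂ w ∷ π₃ w ∷ π₁ v ∷ π₂ v ∷ π₃ v ∷ []

  normalise : Vec (Expr 9) 9
  normalise = var (# 0) ∷ var (# 1) ∷ domain-normal-form x
            ∷ var (# 3) ∷ var (# 4) ∷ domain-normal-form y
            ∷ var (# 6) ∷ var (# 7) ∷ domain-normal-form u ∷ []

  env-normal : ∀ z w v → InDom z → InDom w → InDom v →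
               env z w v Denotes normalise Under env z w v
  env-normal z w v z∈ w∈ v∈ =
    refl ∷ refl ∷ InDom⇒π₃-normal z z∈ ∷ refl ∷ refl ∷ InDom⇒π₃-normal w w∈ ∷
    refl ∷ refl ∷ InDom⇒π₃-normal v v∈ ∷ []

  _⇔ᵗ_ : TripleExpr 9 → TripleExpr 9 → Set
  (a₁ , a₂ , a₃) ⇔ᵗ (b₁ , b₂ , b₃) =
    a₁ [ normalise ] ⇔ᵇ b₁ [ normalise ] ×
    a₂ [ normalise ] ⇔ᵇ b₂ [ normalise ] ×
    a₃ [ normalise ] ⇔ᵇ b₃ [ normalise ]

  ≋-by-truth-table : ∀ E F → {E ⇔ᵗ F} → ∀ z w v → InDom z → InDom w → InDom v →
                     ⟦ E ⟧³ (env z w v) ≋ ⟦ F ⟧³ (env z w v)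
  ≋-by-truth-table (a₁ , a₂ , a₃) (b₁ , b₂ , b₃) {t₁ , t₂ , t₃} z w v z∈ w∈ v∈ =
      solve-under normalise a₁ b₁ t₁ ρ≈σ
    , solve-under normalise a₂ b₂ t₂ ρ≈σ
    , solve-under normalise a₃ b₃ t₃ ρ≈σ
    where ρ≈σ = env-normal z w v z∈ w∈ v∈

  InDomᵗ : TripleExpr 9 → Set
  InDomᵗ (a , b , d) =
    (d ∧ₑ (a ∨ₑ b)) [ normalise ] ⇔ᵇ d [ normalise ] ×
    (a ∧ₑ b ∧ₑ d) [ normalise ] ⇔ᵇ ⊥ₑ

  InDom-by-truth-table : ∀ E → {InDomᵗ E} → ∀ z w v → InDom z → InDom w → InDom v →
                         InDom (⟦ E ⟧³ (env z w v))
  InDom-by-truth-table (a , b , d) {t₁ , t₂} z w v z∈ w∈ v∈ =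
      solve-under normalise (d ∧ₑ (a ∨ₑ b)) d t₁ ρ≈σ
    , solve-under normalise (a ∧ₑ b ∧ₑ d) ⊥ₑ t₂ ρ≈σ
    where ρ≈σ = env-normal z w v z∈ w∈ v∈

theorem4p5 : ∀ {c ℓ} (𝓑 : BooleanAlgebra c ℓ) → Twist.IsBoundedTwistLattice 𝓑
theorem4p5 𝓑 =
    (λ z w z∈ w∈ → InDom-by-truth-table (x ∧ᵗ y) z w w z∈ w∈ w∈)
  , (λ z w z∈ w∈ → InDom-by-truth-table (x ∨ᵗ y) z w w z∈ w∈ w∈)
  , T̃-InDom
  , F̃-InDom
  , (λ z z∈ → ≋-by-truth-table (x ∧ᵗ x) x z z z z∈ z∈ z∈)
  , (λ z z∈ → ≋-by-truth-table (x ∨ᵗ x) x z z z z∈ z∈ z∈)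
  , (λ z w z∈ w∈ → ≋-by-truth-table (x ∧ᵗ y) (y ∧ᵗ x) z w w z∈ w∈ w∈)
  , (λ z w z∈ w∈ → ≋-by-truth-table (x ∨ᵗ y) (y ∨ᵗ x) z w w z∈ w∈ w∈)
  , (λ z w v z∈ w∈ v∈ → ≋-by-truth-table ((x ∧ᵗ y) ∧ᵗ u) (x ∧ᵗ (y ∧ᵗ u)) z w v z∈ w∈ v∈)
  , (λ z w v z∈ w∈ v∈ → ≋-by-truth-table ((x ∨ᵗ y) ∨ᵗ u) (x ∨ᵗ (y ∨ᵗ u)) z w v z∈ w∈ v∈)
  , (λ z w z∈ w∈ → ≋-by-truth-table (x ∧ᵗ (x ∨ᵗ y)) x z w w z∈ w∈ w∈)
  , (λ z w z∈ w∈ → ≋-by-truth-table (x ∨ᵗ (x ∧ᵗ y)) x z w w z∈ w∈ w∈)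
  , (λ z z∈ → ≋-by-truth-table x (x ∧ᵗ Tᵗ) z z z z∈ z∈ z∈)
  , (λ z z∈ → ≋-by-truth-table Fᵗ (Fᵗ ∧ᵗ x) z z z z∈ z∈ z∈)
  where open TwistTruthTables 𝓑
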